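{- Let $k$ be a nonnegative integer, let $G$ be a connected graph and let $X\subseteq V(G)$. Then there exists $S\subseteq X$ such that $S$ is a minimum $k$-power dominating set of $\widehat X$.
   Context: Graphs are finite, simple and undirected. $\widehat X$ is the graph obtained from the induced subgraph $G[X]$ by attaching to each vertex $x\in X$ as many new pendent vertices as $x$ has neighbors in $G-X$. For a graph $H=(V,E)$, nonnegative integer $k$ and $S\subseteq V$, define $\mathscr P^0_{H,k}(S)=N[S]$ and $\mathscr P^{i+1}_{H,k}(S)=\mathscr P^i_{H,k}(S)\cup\bigcup\{N(v): v\in \mathscr P^i_{H,k}(S),\ 1\le |N(v)\setminus \mathscr P^i_{H,k}(S)|\le k\}$. $S$ is a $k$-power dominating set of $H$ if $\mathscr P^\ell_{H,k}(S)=V$ for some $\ell$; a minimum one is one of smallest cardinality. -}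

module Defs where

open import Data.Nat using (ℕ; zero; suc; _≤_; _≤ᵇ_)
open import Data.Bool using (Bool; true; false; _∧_; _∨_; not)
open import Data.Fin using (Fin)
open import Data.Fin.Properties using () renaming (_≟_ to _≟ᶠ_)
open import Data.List using (List; length; filterᵇ; map; _++_; cartesianProduct)
open import Data.Bool.ListAction using (any)
open import Data.List.Membership.Propositional using (_∈_)
open import Data.Sum using (_⊎_; inj₁; inj₂)
open import Data.Product using (_×_; _,_; ∃)
open import Data.List using () renaming (allFin to allFinL)
open import Relation.Binary.PropositionalEquality using (_≡_)
open import Relation.Nullary.Decidable using (⌊_⌋)

record SimpleGraph (n : ℕ) : Set where
  field
    adj    : Fin n → Fin n → Bool
    sym    : ∀ u v → adj u v ≡ adj v u
    irrefl : ∀ v → adj v v ≡ false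
open SimpleGraph public

data Reach {n : ℕ} (G : SimpleGraph n) : Fin n → Fin n → Set where
  here : ∀ {v} → Reach G v v
  step : ∀ {u w v} → adj G u w ≡ true → Reach G w v → Reach G u v

Connected : ∀ {n} → SimpleGraph n → Set
Connected {n} G = ∀ (u v : Fin n) → Reach G u v

-- A finite graph presented by a vertex type V, the list of its vertices
-- (without repetitions) and a Boolean adjacency relation.  Only vertices
-- occurring in `verts` belong to the graph.  Vertex subsets are Boolean
-- predicates on V; only their values on `verts` matter.

record FinGraph : Set₁ where
  field
    V     : Set
    verts : List V
    adjF  : V → V → Bool
open FinGraph public

module _ (H : FinGraph) where

  card : (V H → Bool) → ℕ
  card S = length (filterᵇ S (verts H))

  closedNbhd : (V H → Bool) → (V H → Bool)
  closedNbhd S v = S v ∨ any (λ u → S u ∧ adjF H u v) (verts H)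

  outside : (V H → Bool) → V H → ℕ
  outside P u = length (filterᵇ (λ w → adjF H u w ∧ not (P w)) (verts H))

  propStep : ℕ → (V H → Bool) → (V H → Bool)
  propStep k P v =
    P v ∨ any (λ u → P u ∧ (1 ≤ᵇ outside P u) ∧ (outside P u ≤ᵇ k) ∧ adjF H u v)
              (verts H)

  observed : ℕ → (V H → Bool) → ℕ → (V H → Bool)
  observed k S zero    = closedNbhd S
  observed k S (suc i) = propStep k (observed k S i)

  IsKPDS : ℕ → (V H → Bool) → Set
  IsKPDS k S = ∃ λ ℓ → ∀ v → v ∈ verts H → observed k S ℓ v ≡ true

  IsMinKPDS : ℕ → (V H → Bool) → Set
  IsMinKPDS k S = IsKPDS k S × (∀ T → IsKPDS k T → card S ≤ card T)

-- The graph X̂: G[X] with, for each x ∈ X, one pendent vertex per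
-- neighbour of x in G - X.  The pendent vertex for the edge xy
-- (x ∈ X, y ∉ X) is represented by inj₂ (x , y).

module _ {n : ℕ} (G : SimpleGraph n) (X : Fin n → Bool) where

  private
    _==_ : Fin n → Fin n → Bool
    a == b = ⌊ a ≟ᶠ b ⌋

    isPendent : Fin n × Fin n → Bool
    isPendent (x , y) = X x ∧ not (X y) ∧ adj G x y

    hatAdj : Fin n ⊎ (Fin n × Fin n) → Fin n ⊎ (Fin n × Fin n) → Bool
    hatAdj (inj₁ x) (inj₁ y) = X x ∧ X y ∧ adj G x y
    hatAdj (inj₁ x) (inj₂ p@(a , _)) = isPendent p ∧ (x == a)
    hatAdj (inj₂ p@(a , _)) (inj₁ x) = isPendent p ∧ (x == a)
    hatAdj (inj₂ _) (inj₂ _) = false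

  hat : FinGraph
  hat = record
    { V     = Fin n ⊎ (Fin n × Fin n)
    ; verts = map inj₁ (filterᵇ X (allFinL n))
              ++ map inj₂ (filterᵇ isPendent (cartesianProduct (allFinL n) (allFinL n)))
    ; adjF  = hatAdj
    }

liftSet : ∀ {n} → (Fin n → Bool) → Fin n ⊎ (Fin n × Fin n) → Bool
liftSet S (inj₁ x) = S x
liftSet S (inj₂ _) = false

-- Every k-power dominating set T of X̂ can be pushed into X: keep the
-- X-vertices of T and replace each pendent vertex of T by its unique
-- neighbour.  The closed neighbourhood can only grow, and propagation is
-- monotone in the observed set, so the new set still k-power dominates;
-- and it is no larger, since each vertex of the new set is paid for by
-- itself or by one of its own pendent vertices.  Hence the minimum over
-- the finitely many subsets of X (decidable, because propagation
-- stabilises after |V(X̂)| + 1 rounds) is a minimum over all vertex sets.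
module Submission where

open import Defs hiding (sym)
open import Algebra.Properties.CommutativeSemigroup using (interchange)
open import Data.Bool using (Bool; true; false; T; _∧_; _∨_; not)
open import Data.Bool.Properties using (T?; T-∧; T-∨; T-≡; ∧-conicalʳ)
open import Data.Bool.ListAction using (any)
open import Data.Empty using (⊥-elim)
open import Data.Fin using (Fin; zero; suc)
open import Data.Fin.Properties using (_≟_)
open import Data.List
  using (List; []; _∷_; length; map; _++_; filter; filterᵇ; cartesianProduct; cartesianProductWith; allFin)
open import Data.List.Extrema.Nat using (argmin; argmin-all; f[argmin]≤f[xs])
open import Data.List.Membership.Propositional using (_∈_; find; lose)
open import Data.List.Membership.Propositional.Properties
  using (∈-++⁺ˡ; ∈-++⁻; ∈-map⁺; ∈-map⁻; ∈-map∘filter⁻; ∈-filter⁺; ∈-filter⁻; ∈-allFin;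
         ∈-cartesianProductWith⁺)
open import Data.List.Properties using (length-++; length-filter; filter-++; filter-some)
open import Data.List.Relation.Unary.All as All using (All)
open import Data.List.Relation.Unary.Any using (Any; here; there)
open import Data.List.Relation.Unary.Any.Properties using (any⁺; any⁻; map⁺)
open import Data.Nat using (ℕ; zero; suc; _+_; _∸_; _≤_; _<_; _≤ᵇ_; z≤n; s≤s)
open import Data.Nat.Properties
  using (≤-trans; ≤-reflexive; ≤-total; +-mono-≤; m≤m+n; m≤n+m; m<m+n; +-suc; +-identityʳ;
         m∸n+n≡m; 1+n≰n; ≤ᵇ⇒≤; ≤⇒≤ᵇ; +-commutativeSemigroup; module ≤-Reasoning)
open import Data.Product using (∃; ∃-syntax; _×_; _,_; proj₁; proj₂)
open import Data.Sum using (_⊎_; inj₁; inj₂)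
open import Data.Unit using (tt)
open import Data.Vec.Functional using (Vector; head; tail) renaming ([] to []ᵛ; _∷_ to _∷ᵛ_)
open import Function using (_∘_)
open import Function.Bundles using (_⇔_; Equivalence; mk⇔)
open import Relation.Binary.PropositionalEquality using (_≡_; _≗_; refl; sym; trans; cong; cong₂; subst)
open import Relation.Nullary using (¬_; Dec)
open import Relation.Nullary.Decidable using (fromWitness; toWitness)
import Relation.Nullary.Decidable as Dec

open Equivalence using (to; from)

T-or-T-not : ∀ b → T b ⊎ T (not b)
T-or-T-not true  = inj₁ tt
T-or-T-not false = inj₂ tt

T-not⇒¬T : ∀ {b} → T (not b) → ¬ T b
T-not⇒¬T {true} ()

∧-absorbs : ∀ a b → (T a → T b) → a ∧ b ≡ a
∧-absorbs true  _ a⇒b = to T-≡ (a⇒b tt)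
∧-absorbs false _ _   = refl

module _ {A : Set} where

  _⊆⟨_⟩_ : (A → Bool) → List A → (A → Bool) → Set
  P ⊆⟨ xs ⟩ Q = ∀ {x} → x ∈ xs → T (P x) → T (Q x)

  ≗⇒⊆⟨⟩ : ∀ {P Q} xs → P ≗ Q → P ⊆⟨ xs ⟩ Q
  ≗⇒⊆⟨⟩ _ P≗Q {x} _ = subst T (P≗Q x)

  ⊆⟨⟩-or-counterexample : ∀ P Q xs → P ⊆⟨ xs ⟩ Q ⊎ ∃[ x ] x ∈ xs × T (P x) × T (not (Q x))
  ⊆⟨⟩-or-counterexample P Q [] = inj₁ λ ()
  ⊆⟨⟩-or-counterexample P Q (x ∷ xs) with ⊆⟨⟩-or-counterexample P Q xs
  ... | inj₂ (y , y∈ , Py , ¬Qy) = inj₂ (y , there y∈ , Py , ¬Qy)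
  ... | inj₁ P⊆Q with T-or-T-not (P x) | T-or-T-not (Q x)
  ...   | inj₁ Px  | inj₂ ¬Qx = inj₂ (x , here refl , Px , ¬Qx)
  ...   | inj₁ _   | inj₁ Qx  = inj₁ λ { (here refl) _ → Qx ; (there y∈) → P⊆Q y∈ }
  ...   | inj₂ ¬Px | _        = inj₁ λ { (here refl) Px → ⊥-elim (T-not⇒¬T ¬Px Px)
                                        ; (there y∈) → P⊆Q y∈ }

  count : (A → Bool) → List A → ℕ
  count P xs = length (filterᵇ P xs)

  count≤length : ∀ P xs → count P xs ≤ length xs
  count≤length P = length-filter (T? ∘ P)

  count-pos : ∀ {P xs} → Any (T ∘ P) xs → 0 < count P xs
  count-pos {P} = filter-some (T? ∘ P)

  count-false : ∀ xs → count (λ _ → false) xs ≡ 0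
  count-false []       = refl
  count-false (_ ∷ xs) = count-false xs

  count-++ : ∀ P xs ys → count P (xs ++ ys) ≡ count P xs + count P ys
  count-++ P xs ys = trans (cong length (filter-++ (T? ∘ P) xs ys)) (length-++ (filterᵇ P xs))

  count-filterᵇ : ∀ {P Q} xs → count P (filterᵇ Q xs) ≡ count (λ x → Q x ∧ P x) xs
  count-filterᵇ [] = refl
  count-filterᵇ {P} {Q} (x ∷ xs) with Q x
  ... | false = count-filterᵇ xs
  ... | true with P x
  ...   | true  = cong suc (count-filterᵇ xs)
  ...   | false = count-filterᵇ xs

  count-split : ∀ {P Q} xs → P ⊆⟨ xs ⟩ Q →
    count Q xs ≡ count P xs + count (λ x → Q x ∧ not (P x)) xs
  count-split [] _ = refl
  count-split {P} {Q} (x ∷ xs) P⊆Q with P x in Px | Q x in Qx | count-split xs (P⊆Q ∘ there)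
  ... | true  | true  | split = cong suc split
  ... | false | true  | split = trans (cong suc split) (sym (+-suc _ _))
  ... | false | false | split = split
  ... | true  | false | _     = ⊥-elim (subst T Qx (P⊆Q (here refl) (subst T (sym Px) tt)))

  count-mono : ∀ {P Q} xs → P ⊆⟨ xs ⟩ Q → count P xs ≤ count Q xs
  count-mono xs P⊆Q = ≤-trans (m≤m+n _ _) (≤-reflexive (sym (count-split xs P⊆Q)))

  count-mono-< : ∀ {P Q x} xs → P ⊆⟨ xs ⟩ Q → x ∈ xs → T (not (P x)) → T (Q x) →
    count P xs < count Q xs
  count-mono-< xs P⊆Q x∈ ¬Px Qx = ≤-trans
    (m<m+n _ (count-pos (lose x∈ (from T-∧ (Qx , ¬Px)))))
    (≤-reflexive (sym (count-split xs P⊆Q)))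

module _ {A B : Set} where

  count-map : ∀ P (f : A → B) xs → count P (map f xs) ≡ count (P ∘ f) xs
  count-map P f [] = refl
  count-map P f (x ∷ xs) with P (f x)
  ... | true  = cong suc (count-map P f xs)
  ... | false = count-map P f xs

  -- Each P-element is charged to itself or to one of its own Q-pairs.
  count-≤-witnessed : ∀ {P R : A → Bool} {Q : A × B → Bool} xs ys →
    (∀ {x} → T (P x) → T (R x) ⊎ Any (λ y → T (Q (x , y))) ys) →
    count P xs ≤ count R xs + count Q (cartesianProduct xs ys)
  count-≤-witnessed [] ys _ = z≤n
  count-≤-witnessed {P} {R} {Q} (x ∷ xs) ys witness = begin
    count P (x ∷ [] ++ xs)
      ≡⟨ count-++ P (x ∷ []) xs ⟩
    count P (x ∷ []) + count P xs
      ≤⟨ +-mono-≤ single (count-≤-witnessed xs ys witness) ⟩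
    (count R (x ∷ []) + count Q (map (x ,_) ys)) + (count R xs + count Q (cartesianProduct xs ys))
      ≡⟨ interchange +-commutativeSemigroup (count R (x ∷ [])) (count Q (map (x ,_) ys)) (count R xs) _ ⟩
    (count R (x ∷ []) + count R xs) + (count Q (map (x ,_) ys) + count Q (cartesianProduct xs ys))
      ≡⟨ sym (cong₂ _+_ (count-++ R (x ∷ []) xs) (count-++ Q (map (x ,_) ys) (cartesianProduct xs ys))) ⟩
    count R (x ∷ xs) + count Q (cartesianProduct (x ∷ xs) ys) ∎
    where
    open ≤-Reasoning
    single : count P (x ∷ []) ≤ count R (x ∷ []) + count Q (map (x ,_) ys)
    single with P x in Px
    ... | false = z≤n
    ... | true with witness (subst T (sym Px) tt)
    ...   | inj₁ Rx  = ≤-trans (count-pos {P = R} {xs = x ∷ []} (here Rx)) (m≤m+n _ _)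
    ...   | inj₂ Qxy = ≤-trans (count-pos {P = Q} {xs = map (x ,_) ys} (map⁺ Qxy)) (m≤n+m _ _)

-- Until the chain stops growing it gains an element of xs at every step,
-- so it has stopped by step |xs| + 1.
chain-stabilises : ∀ {A : Set} (xs : List A) (P : ℕ → A → Bool) →
  (∀ i → P i ⊆⟨ xs ⟩ P (suc i)) →
  (∀ {i j} → P i ⊆⟨ xs ⟩ P j → P (suc i) ⊆⟨ xs ⟩ P (suc j)) →
  ∀ ℓ → P ℓ ⊆⟨ xs ⟩ P (suc (length xs))
chain-stabilises xs P increasing monotone = stable
  where
  L = suc (length xs)

  ascend : ∀ i m → P i ⊆⟨ xs ⟩ P (m + i)
  ascend i zero    _  = λ t → t
  ascend i (suc m) x∈ = increasing (m + i) x∈ ∘ ascend i m x∈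

  stays : ∀ {j} → P (suc j) ⊆⟨ xs ⟩ P j → ∀ m → P (m + j) ⊆⟨ xs ⟩ P j
  stays stuck zero    _  = λ t → t
  stays stuck (suc m) x∈ = stuck x∈ ∘ monotone (stays stuck m) x∈

  progress : ∀ i → i ≤ count (P i) xs ⊎ P (suc i) ⊆⟨ xs ⟩ P i
  progress zero = inj₁ z≤n
  progress (suc i) with progress i
  ... | inj₂ stuck = inj₂ (monotone stuck)
  ... | inj₁ i≤count with ⊆⟨⟩-or-counterexample (P (suc i)) (P i) xs
  ...   | inj₁ stuck = inj₂ (monotone stuck)
  ...   | inj₂ (x , x∈ , new , ¬old) =
          inj₁ (≤-trans (s≤s i≤count) (count-mono-< xs (increasing i) x∈ ¬old new))

  stable : ∀ ℓ → P ℓ ⊆⟨ xs ⟩ P L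
  stable ℓ with progress L
  ... | inj₁ L≤count = ⊥-elim (1+n≰n (≤-trans L≤count (count≤length (P L) xs)))
  ... | inj₂ stuck with ≤-total ℓ L
  ...   | inj₁ ℓ≤L = subst (λ j → P ℓ ⊆⟨ xs ⟩ P j) (m∸n+n≡m ℓ≤L) (ascend ℓ (L ∸ ℓ))
  ...   | inj₂ L≤ℓ = subst (λ j → P j ⊆⟨ xs ⟩ P L) (m∸n+n≡m L≤ℓ) (stays stuck (ℓ ∸ L))

allVectors : ∀ n → List (Vector Bool n)
allVectors zero    = []ᵛ ∷ []
allVectors (suc n) = cartesianProductWith _∷ᵛ_ (false ∷ true ∷ []) (allVectors n)

allVectors-complete : ∀ {n} (v : Vector Bool n) → ∃[ u ] u ∈ allVectors n × u ≗ v
allVectors-complete {zero}  v = []ᵛ , here refl , λ ()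
allVectors-complete {suc n} v with allVectors-complete (tail v)
... | u , u∈ , u≗ = head v ∷ᵛ u , ∈-cartesianProductWith⁺ _∷ᵛ_ (bool∈ (head v)) u∈ ,
                    λ { zero → refl ; (suc i) → u≗ i }
  where
  bool∈ : ∀ b → b ∈ false ∷ true ∷ []
  bool∈ false = here refl
  bool∈ true  = there (here refl)

module Neighbourhoods (H : FinGraph) where

  _⊆ᴴ_ : (V H → Bool) → (V H → Bool) → Set
  P ⊆ᴴ Q = P ⊆⟨ verts H ⟩ Q

  closedNbhd-self : ∀ S {v} → T (S v) → T (closedNbhd H S v)
  closedNbhd-self _ Sv = from T-∨ (inj₁ Sv)

  closedNbhd-nbr : ∀ S {u v} → u ∈ verts H → T (S u) → T (adjF H u v) → T (closedNbhd H S v)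
  closedNbhd-nbr _ u∈ Su uv = from T-∨ (inj₂ (any⁺ _ (lose u∈ (from T-∧ (Su , uv)))))

  closedNbhd⁻ : ∀ {S v} → T (closedNbhd H S v) →
    T (S v) ⊎ ∃[ u ] u ∈ verts H × T (S u) × T (adjF H u v)
  closedNbhd⁻ t with to T-∨ t
  ... | inj₁ Sv = inj₁ Sv
  ... | inj₂ a with find (any⁻ _ _ a)
  ...   | u , u∈ , Suv = inj₂ (u , u∈ , to T-∧ Suv)

  closedNbhd-mono : ∀ {S S′} → S ⊆ᴴ S′ → closedNbhd H S ⊆ᴴ closedNbhd H S′
  closedNbhd-mono {S′ = S′} S⊆S′ v∈ t with closedNbhd⁻ t
  ... | inj₁ Sv                 = closedNbhd-self S′ (S⊆S′ v∈ Sv)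
  ... | inj₂ (u , u∈ , Su , uv) = closedNbhd-nbr S′ u∈ (S⊆S′ u∈ Su) uv

  card-mono : ∀ {S S′} → S ⊆ᴴ S′ → card H S ≤ card H S′
  card-mono = count-mono (verts H)

module Propagation (H : FinGraph) (k : ℕ) where

  open Neighbourhoods H public

  outside-antitone : ∀ {P Q} → P ⊆ᴴ Q → ∀ u → outside H Q u ≤ outside H P u
  outside-antitone {P} {Q} P⊆Q u = count-mono (verts H) outside-P
    where
    outside-P : (λ w → adjF H u w ∧ not (Q w)) ⊆ᴴ (λ w → adjF H u w ∧ not (P w))
    outside-P {w} w∈ t with to T-∧ t | T-or-T-not (P w)
    ... | uw , _   | inj₂ ¬Pw = from T-∧ (uw , ¬Pw)
    ... | _  , ¬Qw | inj₁ Pw  = ⊥-elim (T-not⇒¬T ¬Qw (P⊆Q w∈ Pw))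

  propStep-self : ∀ P {v} → T (P v) → T (propStep H k P v)
  propStep-self _ Pv = from T-∨ (inj₁ Pv)

  propStep-forced : ∀ P {u v} → u ∈ verts H → T (P u) →
    1 ≤ outside H P u → outside H P u ≤ k → T (adjF H u v) → T (propStep H k P v)
  propStep-forced _ u∈ Pu 1≤out out≤k uv = from T-∨ (inj₂ (any⁺ _ (lose u∈
    (from T-∧ (Pu , from T-∧ (≤⇒≤ᵇ 1≤out , from T-∧ (≤⇒≤ᵇ out≤k , uv)))))))

  propStep⁻ : ∀ {P v} → T (propStep H k P v) → T (P v) ⊎
    ∃[ u ] u ∈ verts H × T (P u) × outside H P u ≤ k × T (adjF H u v)
  propStep⁻ {P} {v} t with to (T-∨ {P v}) t
  ... | inj₁ Pv = inj₁ Pv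
  ... | inj₂ a with find (any⁻ _ _ a)
  ...   | u , u∈ , forced with to (T-∧ {P u}) forced
  ...     | Pu , rest with to (T-∧ {outside H P u ≤ᵇ k}) (proj₂ (to (T-∧ {1 ≤ᵇ outside H P u}) rest))
  ...       | out≤k , uv = inj₂ (u , u∈ , Pu , ≤ᵇ⇒≤ _ k out≤k , uv)

  -- Either v ∈ Q already, or v witnesses 1 ≤ |N(u) ∖ Q|, so u still forces in Q.
  propStep-mono : ∀ {P Q} → P ⊆ᴴ Q → propStep H k P ⊆ᴴ propStep H k Q
  propStep-mono {Q = Q} P⊆Q {v} v∈ t with propStep⁻ t
  ... | inj₁ Pv = propStep-self Q (P⊆Q v∈ Pv)
  ... | inj₂ (u , u∈ , Pu , out≤k , uv) with T-or-T-not (Q v)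
  ...   | inj₁ Qv  = propStep-self Q Qv
  ...   | inj₂ ¬Qv = propStep-forced Q u∈ (P⊆Q u∈ Pu)
                       (count-pos (lose v∈ (from T-∧ (uv , ¬Qv))))
                       (≤-trans (outside-antitone P⊆Q u) out≤k) uv

  observed-mono : ∀ {A B} → closedNbhd H A ⊆ᴴ closedNbhd H B →
    ∀ i → observed H k A i ⊆ᴴ observed H k B i
  observed-mono N⊆N zero    = N⊆N
  observed-mono N⊆N (suc i) = propStep-mono (observed-mono N⊆N i)

  observed-stabilises : ∀ S ℓ → observed H k S ℓ ⊆ᴴ observed H k S (suc (length (verts H)))
  observed-stabilises S =
    chain-stabilises (verts H) (observed H k S) (λ i _ → propStep-self (observed H k S i)) propStep-mono

  IsKPDS-closedNbhd-mono : ∀ {A B} → closedNbhd H A ⊆ᴴ closedNbhd H B → IsKPDS H k A → IsKPDS H k B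
  IsKPDS-closedNbhd-mono N⊆N (ℓ , covers) =
    ℓ , λ v v∈ → to T-≡ (observed-mono N⊆N ℓ v∈ (from T-≡ (covers v v∈)))

  IsKPDS-mono : ∀ {A B} → A ⊆ᴴ B → IsKPDS H k A → IsKPDS H k B
  IsKPDS-mono = IsKPDS-closedNbhd-mono ∘ closedNbhd-mono

  IsKPDS⇔covered : ∀ S → IsKPDS H k S ⇔ All (T ∘ observed H k S (suc (length (verts H)))) (verts H)
  IsKPDS⇔covered S = mk⇔
    (λ (ℓ , covers) → All.tabulate λ v∈ → observed-stabilises S ℓ v∈ (from T-≡ (covers _ v∈)))
    (λ covered → suc (length (verts H)) , λ v v∈ → to T-≡ (All.lookup covered v∈))

  isKPDS? : ∀ S → Dec (IsKPDS H k S)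
  isKPDS? S =
    Dec.map′ (from (IsKPDS⇔covered S)) (to (IsKPDS⇔covered S)) (All.all? (T? ∘ _) (verts H))

  minimum-among : (Cs : List (V H → Bool)) →
    (∀ S → IsKPDS H k S → ∃[ C ] C ∈ Cs × IsKPDS H k C × card H C ≤ card H S) →
    ∀ {S} → IsKPDS H k S → ∃[ C ] C ∈ Cs × IsMinKPDS H k C
  minimum-among Cs improve S-kpds with improve _ S-kpds
  ... | C₀ , C₀∈ , C₀-kpds , _ = M , proj₁ M-good , proj₂ M-good , M-minimal
    where
    dominating = filter isKPDS? Cs
    M = argmin (card H) C₀ dominating

    M-good : M ∈ Cs × IsKPDS H k M
    M-good = argmin-all (card H) (C₀∈ , C₀-kpds) (All.tabulate (∈-filter⁻ isKPDS?))

    M-minimal : ∀ S → IsKPDS H k S → card H M ≤ card H S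
    M-minimal S S-kpds with improve S S-kpds
    ... | C , C∈ , C-kpds , C≤S =
          ≤-trans (All.lookup (f[argmin]≤f[xs] C₀ dominating) (∈-filter⁺ isKPDS? C∈ C-kpds)) C≤S

module Hat {n : ℕ} (G : SimpleGraph n) (X : Fin n → Bool) (k : ℕ) where

  Ĥ : FinGraph
  Ĥ = hat G X

  open Propagation Ĥ k

  isLeaf : Fin n × Fin n → Bool
  isLeaf (x , y) = X x ∧ not (X y) ∧ adj G x y

  -- verts Ĥ is definitionally map inj₁ cores ++ map inj₂ leaves.
  cores : List (Fin n)
  cores = filterᵇ X (allFin n)

  pairs : List (Fin n × Fin n)
  pairs = cartesianProduct (allFin n) (allFin n)

  leaves : List (Fin n × Fin n)
  leaves = filterᵇ isLeaf pairs

  data HatVertex : V Ĥ → Set where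
    core : ∀ x → T (X x) → HatVertex (inj₁ x)
    leaf : ∀ x y → T (isLeaf (x , y)) → HatVertex (inj₂ (x , y))

  hatVertex : ∀ {v} → v ∈ verts Ĥ → HatVertex v
  hatVertex v∈ with ∈-++⁻ (map inj₁ cores) v∈
  ... | inj₁ c∈ with ∈-map∘filter⁻ inj₁ (T? ∘ X) {xs = allFin n} c∈
  ...   | x , _ , refl , Xx = core x Xx
  hatVertex v∈ | inj₂ l∈ with ∈-map∘filter⁻ inj₂ (T? ∘ isLeaf) {xs = pairs} l∈
  ...   | (x , y) , _ , refl , l = leaf x y l

  core∈ : ∀ x → T (X x) → inj₁ x ∈ verts Ĥ
  core∈ x Xx = ∈-++⁺ˡ (∈-map⁺ inj₁ (∈-filter⁺ (T? ∘ X) (∈-allFin x) Xx))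

  leaf-support : ∀ x y → T (isLeaf (x , y)) → T (X x)
  leaf-support x _ = proj₁ ∘ to (T-∧ {X x})

  support-adj-leaf : ∀ x y → T (isLeaf (x , y)) → T (adjF Ĥ (inj₁ x) (inj₂ (x , y)))
  support-adj-leaf _ _ l = from T-∧ (l , fromWitness refl)

  leaf-nbr : ∀ {x y v} → T (adjF Ĥ (inj₂ (x , y)) v) → v ≡ inj₁ x
  leaf-nbr {x} {y} {inj₁ x′} t =
    cong inj₁ (toWitness {a? = x′ ≟ x} (proj₂ (to (T-∧ {isLeaf (x , y)}) t)))
  leaf-nbr {v = inj₂ _} ()

  card-hat : ∀ S → card Ĥ S ≡ count (S ∘ inj₁) cores + count (S ∘ inj₂) leaves
  card-hat S = trans (count-++ S (map inj₁ cores) (map inj₂ leaves))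
                     (cong₂ _+_ (count-map S inj₁ cores) (count-map S inj₂ leaves))

  retract : (V Ĥ → Bool) → Fin n → Bool
  retract S x = X x ∧ (S (inj₁ x) ∨ any (λ y → isLeaf (x , y) ∧ S (inj₂ (x , y))) (allFin n))

  retract⊆X : ∀ S {x} → T (retract S x) → T (X x)
  retract⊆X S = proj₁ ∘ to T-∧

  retract-core : ∀ S x → T (X x) → T (S (inj₁ x)) → T (retract S x)
  retract-core _ _ Xx Sx = from T-∧ (Xx , from T-∨ (inj₁ Sx))

  retract-leaf : ∀ S x y → T (isLeaf (x , y)) → T (S (inj₂ (x , y))) → T (retract S x)
  retract-leaf _ x y l Sl =
    from T-∧ (leaf-support x y l , from T-∨ (inj₂ (any⁺ _ (lose (∈-allFin y) (from T-∧ (l , Sl))))))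

  closedNbhd-retract : ∀ S → closedNbhd Ĥ S ⊆ᴴ closedNbhd Ĥ (liftSet (retract S))
  closedNbhd-retract S {v} v∈ t with closedNbhd⁻ t | hatVertex v∈
  ... | inj₁ Sv | core x Xx  = closedNbhd-self (liftSet (retract S)) (retract-core S x Xx Sv)
  ... | inj₁ Sv | leaf x y l =
        closedNbhd-nbr (liftSet (retract S)) {v = inj₂ (x , y)}
          (core∈ x (leaf-support x y l)) (retract-leaf S x y l Sv) (support-adj-leaf x y l)
  ... | inj₂ (u , u∈ , Su , uv) | _ with hatVertex u∈
  ...   | core x Xx  = closedNbhd-nbr (liftSet (retract S)) u∈ (retract-core S x Xx Su) uv
  ...   | leaf x y l with leaf-nbr {x} {y} {v} uv
  ...     | refl = closedNbhd-self (liftSet (retract S)) (retract-leaf S x y l Su)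

  card-retract : ∀ S → card Ĥ (liftSet (retract S)) ≤ card Ĥ S
  card-retract S = begin
    card Ĥ (liftSet R)
      ≡⟨ card-hat (liftSet R) ⟩
    count R cores + count (λ _ → false) leaves
      ≡⟨ cong (count R cores +_) (count-false leaves) ⟩
    count R cores + 0
      ≡⟨ +-identityʳ _ ⟩
    count R cores
      ≡⟨ count-filterᵇ (allFin n) ⟩
    count (λ x → X x ∧ R x) (allFin n)
      ≤⟨ count-≤-witnessed (allFin n) (allFin n) witness ⟩
    count (λ x → X x ∧ S (inj₁ x)) (allFin n)
      + count (λ p → isLeaf p ∧ S (inj₂ p)) pairs
      ≡⟨ sym (cong₂ _+_ (count-filterᵇ (allFin n)) (count-filterᵇ pairs)) ⟩
    count (S ∘ inj₁) cores + count (S ∘ inj₂) leaves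
      ≡⟨ sym (card-hat S) ⟩
    card Ĥ S ∎
    where
    open ≤-Reasoning
    R = retract S
    witness : ∀ {x} → T (X x ∧ R x) →
      T (X x ∧ S (inj₁ x)) ⊎ Any (λ y → T (isLeaf (x , y) ∧ S (inj₂ (x , y)))) (allFin n)
    witness {x} t with to (T-∧ {X x}) t
    ... | Xx , Rx with to (T-∨ {S (inj₁ x)}) (proj₂ (to (T-∧ {X x}) Rx))
    ...   | inj₁ Sx     = inj₁ (from T-∧ (Xx , Sx))
    ...   | inj₂ leafSx = inj₂ (any⁻ _ _ leafSx)

  X-isKPDS : IsKPDS Ĥ k (liftSet X)
  X-isKPDS = 0 , λ v v∈ → to T-≡ (dominated v∈)
    where
    dominated : ∀ {v} → v ∈ verts Ĥ → T (closedNbhd Ĥ (liftSet X) v)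
    dominated v∈ with hatVertex v∈
    ... | core x Xx  = closedNbhd-self (liftSet X) Xx
    ... | leaf x y l =
          closedNbhd-nbr (liftSet X) {v = inj₂ (x , y)}
            (core∈ x (leaf-support x y l)) (leaf-support x y l) (support-adj-leaf x y l)

  restrictToX : Vector Bool n → Fin n → Bool
  restrictToX u x = u x ∧ X x

  candidates : List (V Ĥ → Bool)
  candidates = map (liftSet ∘ restrictToX) (allVectors n)

  candidate-for : ∀ S → (∀ {x} → T (S x) → T (X x)) → ∃[ C ] C ∈ candidates × C ≗ liftSet S
  candidate-for S S⊆X with allVectors-complete S
  ... | u , u∈ , u≗S = liftSet (restrictToX u) , ∈-map⁺ (liftSet ∘ restrictToX) u∈ , same
    where
    same : liftSet (restrictToX u) ≗ liftSet S
    same (inj₁ x) = trans (cong (_∧ X x) (u≗S x)) (∧-absorbs (S x) (X x) S⊆X)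
    same (inj₂ _) = refl

  retract-improves : ∀ S → IsKPDS Ĥ k S →
    ∃[ C ] C ∈ candidates × IsKPDS Ĥ k C × card Ĥ C ≤ card Ĥ S
  retract-improves S S-kpds with candidate-for (retract S) (retract⊆X S)
  ... | C , C∈ , C≗R =
        C , C∈ ,
        IsKPDS-mono (≗⇒⊆⟨⟩ (verts Ĥ) (sym ∘ C≗R))
          (IsKPDS-closedNbhd-mono (closedNbhd-retract S) S-kpds) ,
        ≤-trans (card-mono (≗⇒⊆⟨⟩ (verts Ĥ) C≗R)) (card-retract S)

  minimum-inside-X : ∃ λ (S : Fin n → Bool) →
    (∀ x → S x ≡ true → X x ≡ true) × IsMinKPDS Ĥ k (liftSet S)
  minimum-inside-X with minimum-among candidates retract-improves X-isKPDS
  ... | C , C∈ , C-min with ∈-map⁻ (liftSet ∘ restrictToX) C∈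
  ...   | u , _ , refl = restrictToX u , (λ x → ∧-conicalʳ (u x) (X x)) , C-min

lemma4p2 : (k n : ℕ) (G : SimpleGraph n) → Connected G → (X : Fin n → Bool) →
    ∃ λ (S : Fin n → Bool) →
      (∀ x → S x ≡ true → X x ≡ true) × IsMinKPDS (hat G X) k (liftSet S)
lemma4p2 k n G _ X = Hat.minimum-inside-X G X k
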